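{- For integers $n,m\geqslant 0$, let $\mathfrak{G}_{n,m}$ be the set of inversion sequences of length $n$ that avoid both patterns $010$ and $120$ and have maximum value $m$; let $\mathfrak{g}_{n,m} = \#\mathfrak{G}_{n,m}$. For $N,K\geqslant 0$ let $\mathfrak{e}_{N,K}$ be the number of words of length $N$ over the alphabet $\{1,\dots,K\}$ avoiding both $010$ and $120$ (so $\mathfrak{e}_{0,K}=1$). Then for all $n\geqslant 0$ and $m \geqslant 1$, $$\mathfrak{g}_{n,m} = \sum_{p = m+1}^n \sum_{j = 0}^{m-1} \mathfrak{g}_{p-1,j} \cdot \mathfrak{e}_{n-p, m-j}.$$
   Context: An inversion sequence of length $n$ is a sequence $(\sigma_1,\dots,\sigma_n)$ of nonnegative integers with $\sigma_i<i$ for all $i$. A sequence or word $\sigma$ contains a pattern $p=(p_1,\dots,p_k)$ if some subsequence $(\sigma_{i_1},\dots,\sigma_{i_k})$ with $i_1<\dots<i_k$ is order-isomorphic to $p$; otherwise it avoids $p$. Avoiding $010$ means no indices $a<b<c$ with $\sigma_a=\sigma_c<\sigma_b$; avoiding $120$ means no indices $a<b<c$ with $\sigma_c<\sigma_a<\sigma_b$. Words over $\{1,\dots,K\}$ need not use every letter. -}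

module Defs where

open import Data.Nat using (ℕ; zero; suc; _+_; _*_; _∸_; _<ᵇ_; _≡ᵇ_; _⊔_)
open import Data.Bool using (Bool; true; false; _∧_; _∨_; if_then_else_)
open import Data.List using (List; []; _∷_; map; concatMap; length; filter; upTo; foldr; applyUpTo)
open import Data.Bool.ListAction using (any)
open import Data.Nat.ListAction using (sum)
open import Data.List.Membership.Propositional using (_∈_)

somePair : (ℕ → ℕ → Bool) → List ℕ → Bool
somePair P [] = false
somePair P (y ∷ ys) = any (P y) ys ∨ somePair P ys

someTriple : (ℕ → ℕ → ℕ → Bool) → List ℕ → Bool
someTriple R [] = false
someTriple R (x ∷ xs) = somePair (R x) xs ∨ someTriple R xs

pat010 : ℕ → ℕ → ℕ → Bool
pat010 x y z = (x ≡ᵇ z) ∧ (x <ᵇ y)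

pat120 : ℕ → ℕ → ℕ → Bool
pat120 x y z = (z <ᵇ x) ∧ (x <ᵇ y)

contains010 : List ℕ → Bool
contains010 = someTriple pat010

contains120 : List ℕ → Bool
contains120 = someTriple pat120

avoidsBoth : List ℕ → Bool
avoidsBoth w = if contains010 w ∨ contains120 w then false else true

maxList : List ℕ → ℕ
maxList = foldr _⊔_ 0

-- All lists (σ_1,…,σ_n) with 0 ≤ σ_i < i  (inversion sequences of length n).
-- invSeqs n is built by appending a last entry σ_n ∈ {0,…,n-1}.
snoc : List ℕ → ℕ → List ℕ
snoc [] y = y ∷ []
snoc (x ∷ xs) y = x ∷ snoc xs y

invSeqs : ℕ → List (List ℕ)
invSeqs zero = [] ∷ []
invSeqs (suc n) = concatMap (λ s → map (snoc s) (upTo (suc n))) (invSeqs n)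

words : ℕ → ℕ → List (List ℕ)
words zero K = [] ∷ []
words (suc N) K = concatMap (λ w → map (_∷ w) (applyUpTo suc K)) (words N K)

-- 𝔤_{n,m}: number of inversion sequences of length n avoiding 010 and 120
-- with maximum value m (max of the empty sequence is 0).
g : ℕ → ℕ → ℕ
g n m = length (filter (λ s → Data.Bool.T? (avoidsBoth s ∧ (maxList s ≡ᵇ m))) (invSeqs n))
  where import Data.Bool

e : ℕ → ℕ → ℕ
e N K = length (filter (λ w → Data.Bool.T? (avoidsBoth w)) (words N K))
  where import Data.Bool

-- Σ_{i=a}^{b} f i  (empty if b < a)
sumFromTo : ℕ → ℕ → (ℕ → ℕ) → ℕ
sumFromTo a b f = sum (map (λ k → f (a + k)) (upTo (suc b ∸ a)))

module Submission where

-- Cut a sequence s with maximum m ≥ 1 at the first occurrence of m, say at position p: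
-- s = u ++ m ∷ t with every entry of u below m and every entry of t at most m. Avoiding 010 and
-- 120 together means having no x < y followed later by some z ≤ x. Such an occurrence in
-- u ++ m ∷ t lies inside u, inside t, or has x in u and z in t (and then x, m, z is one too), so
-- s avoids both patterns iff u and t do and every entry of t exceeds j = max u. As m < p, the
-- inversion-sequence bounds on t hold automatically: t ranges over all avoiding words of length
-- n − p over {j+1, …, m}, counted after a shift by 𝔢_{n−p,m−j}, while u ranges over the
-- 𝔤_{p−1,j} avoiding inversion sequences of length p − 1 with maximum j < m.

open import Algebra.Bundles using (CommutativeMonoid)
open import Data.Bool using (Bool; true; false; T; not; _∧_; _∨_; if_then_else_)
open import Data.Bool.ListAction using (any; all; or)
open import Data.Bool.Properties
  using (∨-assoc; ∨-comm; ∨-identityʳ; ∧-assoc; ∧-comm; ∧-zeroʳ; ∧-identityʳ; ∧-distribʳ-∨;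
         ∨-commutativeMonoid; ∧-commutativeMonoid; ∨-∧-booleanAlgebra; T-∨; T-∧; T-≡)
open import Data.Bool.Solver using (module ∨-∧-Solver)
open import Data.List using (List; []; _∷_; _++_; map; concatMap; filter; length; applyUpTo; upTo)
open import Data.List.Properties using (map-++; map-∘; map-cong; ++-identityʳ)
open import Data.List.Relation.Unary.All as All using (All; []; _∷_)
open import Data.Nat using (ℕ; zero; suc; _+_; _*_; _∸_; _≤_; _<_; _≥_; _⊔_; _<ᵇ_; _≡ᵇ_; z≤n; s≤s)
open import Data.Nat.ListAction using (sum)
open import Data.Nat.ListAction.Properties using (sum-++)
open import Data.Nat.Properties
open import Data.Product using (proj₂)
open import Data.Sum using (inj₁; inj₂)
open import Data.Unit using (tt)
open import Function using (_∘_)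
open import Function.Bundles using (Equivalence)
open import Relation.Binary.PropositionalEquality
open import Relation.Nullary.Decidable using (T?)
open import Relation.Nullary.Negation using (contradiction)

open import Algebra.Lattice.Properties.BooleanAlgebra ∨-∧-booleanAlgebra using (deMorgan₂)
open import Algebra.Properties.CommutativeSemigroup +-commutativeSemigroup
  using () renaming (interchange to +-interchange)
open import Algebra.Properties.CommutativeSemigroup (CommutativeMonoid.commutativeSemigroup ∨-commutativeMonoid)
  using () renaming (interchange to ∨-interchange)
open import Algebra.Properties.CommutativeSemigroup (CommutativeMonoid.commutativeSemigroup ∧-commutativeMonoid)
  using () renaming (interchange to ∧-interchange)

open import Defs

open ≡-Reasoning

∑ : {A : Set} → List A → (A → ℕ) → ℕ
∑ xs f = sum (map f xs)

infix 5 ∑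
syntax ∑ xs (λ x → e) = ∑[ x ← xs ] e

module _ {A : Set} where

  ∑-cong : (xs : List A) {f h : A → ℕ} → (∀ x → f x ≡ h x) → ∑ xs f ≡ ∑ xs h
  ∑-cong xs eq = cong sum (map-cong eq xs)

  ∑-++ : (xs ys : List A) (f : A → ℕ) → ∑ (xs ++ ys) f ≡ ∑ xs f + ∑ ys f
  ∑-++ xs ys f = trans (cong sum (map-++ f xs ys)) (sum-++ (map f xs) (map f ys))

  ∑-+ : (xs : List A) (f h : A → ℕ) → ∑[ x ← xs ] (f x + h x) ≡ ∑ xs f + ∑ xs h
  ∑-+ [] f h = refl
  ∑-+ (x ∷ xs) f h rewrite ∑-+ xs f h = +-interchange (f x) (h x) (∑ xs f) (∑ xs h)

  ∑-*ˡ : (xs : List A) (c : ℕ) (f : A → ℕ) → ∑[ x ← xs ] (c * f x) ≡ c * ∑ xs f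
  ∑-*ˡ [] c f = sym (*-zeroʳ c)
  ∑-*ˡ (x ∷ xs) c f rewrite ∑-*ˡ xs c f = sym (*-distribˡ-+ c (f x) (∑ xs f))

  ∑-*ʳ : (xs : List A) (f : A → ℕ) (c : ℕ) → ∑[ x ← xs ] (f x * c) ≡ ∑ xs f * c
  ∑-*ʳ [] f c = refl
  ∑-*ʳ (x ∷ xs) f c rewrite ∑-*ʳ xs f c = sym (*-distribʳ-+ c (f x) (∑ xs f))

  ∑-zero : (xs : List A) {f : A → ℕ} → (∀ x → f x ≡ 0) → ∑ xs f ≡ 0
  ∑-zero [] eq = refl
  ∑-zero (x ∷ xs) eq rewrite eq x = ∑-zero xs eq

module _ {A B : Set} where

  ∑-map : (h : A → B) (xs : List A) (f : B → ℕ) → ∑ (map h xs) f ≡ ∑ xs (f ∘ h)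
  ∑-map h xs f = cong sum (sym (map-∘ xs))

  ∑-concatMap : (h : A → List B) (xs : List A) (f : B → ℕ) →
    ∑ (concatMap h xs) f ≡ ∑[ x ← xs ] ∑ (h x) f
  ∑-concatMap h [] f = refl
  ∑-concatMap h (x ∷ xs) f =
    trans (∑-++ (h x) (concatMap h xs) f) (cong (∑ (h x) f +_) (∑-concatMap h xs f))

  ∑-comm : (xs : List A) (ys : List B) (f : A → B → ℕ) →
    ∑[ x ← xs ] ∑[ y ← ys ] f x y ≡ ∑[ y ← ys ] ∑[ x ← xs ] f x y
  ∑-comm [] ys f = sym (∑-zero ys (λ _ → refl))
  ∑-comm (x ∷ xs) ys f = trans (cong (∑ ys (f x) +_) (∑-comm xs ys f)) (sym (∑-+ ys (f x) _))

∑-extend : {A B : Set} (ys : List B) (c : A → B → A) (xs : List A) (f : A → ℕ) →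
  ∑ (concatMap (λ x → map (c x) ys) xs) f ≡ ∑[ x ← xs ] ∑[ y ← ys ] f (c x y)
∑-extend ys c xs f = trans (∑-concatMap _ xs f) (∑-cong xs (λ x → ∑-map (c x) ys f))

𝟙 : Bool → ℕ
𝟙 true = 1
𝟙 false = 0

𝟙-∧ : ∀ a b → 𝟙 (a ∧ b) ≡ 𝟙 a * 𝟙 b
𝟙-∧ true b = sym (+-identityʳ (𝟙 b))
𝟙-∧ false b = refl

𝟙-*-cong : ∀ b {x y} → (T b → x ≡ y) → 𝟙 b * x ≡ 𝟙 b * y
𝟙-*-cong true eq = cong (1 *_) (eq tt)
𝟙-*-cong false eq = refl

length-filter-∑ : {A : Set} (p : A → Bool) (xs : List A) →
  length (filter (λ x → T? (p x)) xs) ≡ ∑[ x ← xs ] 𝟙 (p x)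
length-filter-∑ p [] = refl
length-filter-∑ p (x ∷ xs) with p x
... | true = cong suc (length-filter-∑ p xs)
... | false = length-filter-∑ p xs

sumTo : ℕ → (ℕ → ℕ) → ℕ
sumTo zero f = 0
sumTo (suc n) f = f 0 + sumTo n (f ∘ suc)

infix 5 sumTo
syntax sumTo n (λ i → e) = ∑[ i < n ] e

∑-applyUpTo : (f : ℕ → ℕ) (n : ℕ) (F : ℕ → ℕ) → ∑ (applyUpTo f n) F ≡ sumTo n (F ∘ f)
∑-applyUpTo f zero F = refl
∑-applyUpTo f (suc n) F = cong (F (f 0) +_) (∑-applyUpTo (f ∘ suc) n F)

∑-upTo : (n : ℕ) (f : ℕ → ℕ) → ∑ (upTo n) f ≡ sumTo n f
∑-upTo = ∑-applyUpTo (λ i → i)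

sumTo-cong : (n : ℕ) {f h : ℕ → ℕ} → (∀ i → i < n → f i ≡ h i) → sumTo n f ≡ sumTo n h
sumTo-cong zero eq = refl
sumTo-cong (suc n) eq = cong₂ _+_ (eq 0 (s≤s z≤n)) (sumTo-cong n (λ i i<n → eq (suc i) (s≤s i<n)))

sumTo-zero : (n : ℕ) → ∑[ i < n ] 0 ≡ 0
sumTo-zero zero = refl
sumTo-zero (suc n) = sumTo-zero n

sumTo-*ˡ : (n c : ℕ) (f : ℕ → ℕ) → ∑[ i < n ] (c * f i) ≡ c * sumTo n f
sumTo-*ˡ zero c f = sym (*-zeroʳ c)
sumTo-*ˡ (suc n) c f rewrite sumTo-*ˡ n c (f ∘ suc) = sym (*-distribˡ-+ c (f 0) (sumTo n (f ∘ suc)))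

∑-sumTo-comm : {A : Set} (xs : List A) (n : ℕ) (f : A → ℕ → ℕ) →
  ∑[ x ← xs ] ∑[ i < n ] f x i ≡ ∑[ i < n ] ∑[ x ← xs ] f x i
∑-sumTo-comm xs n f = begin
  ∑[ x ← xs ] sumTo n (f x)          ≡⟨ ∑-cong xs (λ x → sym (∑-upTo n (f x))) ⟩
  ∑[ x ← xs ] ∑[ i ← upTo n ] f x i  ≡⟨ ∑-comm xs (upTo n) f ⟩
  ∑[ i ← upTo n ] ∑[ x ← xs ] f x i  ≡⟨ ∑-upTo n _ ⟩
  ∑[ i < n ] ∑[ x ← xs ] f x i       ∎

sumTo-select : (n m : ℕ) (f : ℕ → ℕ) → ∑[ i < n ] (𝟙 (m ≡ᵇ i) * f i) ≡ 𝟙 (m <ᵇ n) * f m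
sumTo-select zero m f = refl
sumTo-select (suc n) zero f = trans (cong (f 0 + 0 +_) (sumTo-zero n)) (+-identityʳ _)
sumTo-select (suc n) (suc m) f = sumTo-select n m (f ∘ suc)

∑-groupBy : {A : Set} (f w : A → ℕ) (m : ℕ) (xs : List A) (h : ℕ → ℕ) →
  ∑[ x ← xs ] 𝟙 (f x <ᵇ m) * (w x * h (f x))
    ≡ ∑[ j < m ] (∑[ x ← xs ] 𝟙 (f x ≡ᵇ j) * w x) * h j
∑-groupBy f w m xs h = begin
  ∑[ x ← xs ] 𝟙 (f x <ᵇ m) * (w x * h (f x))
    ≡⟨ ∑-cong xs (λ x → sumTo-select m (f x) (λ j → w x * h j)) ⟨
  ∑[ x ← xs ] ∑[ j < m ] 𝟙 (f x ≡ᵇ j) * (w x * h j)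
    ≡⟨ ∑-sumTo-comm xs m _ ⟩
  ∑[ j < m ] ∑[ x ← xs ] 𝟙 (f x ≡ᵇ j) * (w x * h j)
    ≡⟨ sumTo-cong m (λ j _ → trans (∑-cong xs (λ x → sym (*-assoc (𝟙 (f x ≡ᵇ j)) (w x) (h j))))
                                   (∑-*ʳ xs _ (h j))) ⟩
  ∑[ j < m ] (∑[ x ← xs ] 𝟙 (f x ≡ᵇ j) * w x) * h j ∎

sumTo-from : (m n : ℕ) (f : ℕ → ℕ) →
  ∑[ i < n ] (𝟙 (m <ᵇ suc i) * f i) ≡ ∑[ i < n ∸ m ] f (m + i)
sumTo-from zero n f = sumTo-cong n (λ i _ → +-identityʳ (f i))
sumTo-from (suc m) zero f = refl
sumTo-from (suc m) (suc n) f = sumTo-from m n (f ∘ suc)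

sumTo-prefix : (m n : ℕ) (f : ℕ → ℕ) → m ≤ n → ∑[ i < n ] (𝟙 (i <ᵇ m) * f i) ≡ sumTo m f
sumTo-prefix zero n f _ = sumTo-zero n
sumTo-prefix (suc m) (suc n) f (s≤s m≤n) = cong₂ _+_ (+-identityʳ (f 0)) (sumTo-prefix m n (f ∘ suc) m≤n)

sumTo-interval : (j k n : ℕ) (f : ℕ → ℕ) → j + k < n →
  ∑[ i < n ] (𝟙 ((j <ᵇ i) ∧ (i <ᵇ suc (j + k))) * f i) ≡ ∑[ i < k ] f (j + suc i)
sumTo-interval zero k (suc n) f (s≤s j+k<n) = sumTo-prefix k n (f ∘ suc) j+k<n
sumTo-interval (suc j) k (suc n) f (s≤s j+k<n) = sumTo-interval j k n (f ∘ suc) j+k<n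

<ᵇ-false : ∀ {m n} → n ≤ m → (m <ᵇ n) ≡ false
<ᵇ-false z≤n = refl
<ᵇ-false (s≤s n≤m) = <ᵇ-false n≤m

<ᵇ-true : ∀ {m n} → m < n → (m <ᵇ n) ≡ true
<ᵇ-true m<n = Equivalence.to T-≡ (<⇒<ᵇ m<n)

≡ᵇ-comm : ∀ m n → (m ≡ᵇ n) ≡ (n ≡ᵇ m)
≡ᵇ-comm zero zero = refl
≡ᵇ-comm zero (suc n) = refl
≡ᵇ-comm (suc m) zero = refl
≡ᵇ-comm (suc m) (suc n) = ≡ᵇ-comm m n

≡ᵇ∨<ᵇ : ∀ x z → (x ≡ᵇ z) ∨ (z <ᵇ x) ≡ (z <ᵇ suc x)
≡ᵇ∨<ᵇ zero zero = refl
≡ᵇ∨<ᵇ zero (suc z) = refl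
≡ᵇ∨<ᵇ (suc x) zero = refl
≡ᵇ∨<ᵇ (suc x) (suc z) = ≡ᵇ∨<ᵇ x z

<ᵇ-⊔ : ∀ x y c → (x ⊔ y <ᵇ c) ≡ (x <ᵇ c) ∧ (y <ᵇ c)
<ᵇ-⊔ x y zero = refl
<ᵇ-⊔ zero y (suc c) = refl
<ᵇ-⊔ (suc x) zero (suc c) = sym (∧-identityʳ (x <ᵇ c))
<ᵇ-⊔ (suc x) (suc y) (suc c) = <ᵇ-⊔ x y c

<ᵇ-suc-⊔ : ∀ z x y → (z <ᵇ suc x) ∨ (z <ᵇ suc y) ≡ (z <ᵇ suc (x ⊔ y))
<ᵇ-suc-⊔ zero x y = refl
<ᵇ-suc-⊔ (suc z) zero y = refl
<ᵇ-suc-⊔ (suc z) (suc x) zero = ∨-identityʳ (z <ᵇ suc x)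
<ᵇ-suc-⊔ (suc z) (suc x) (suc y) = <ᵇ-suc-⊔ z x y

not-<ᵇ-suc : ∀ z j → not (z <ᵇ suc j) ≡ (j <ᵇ z)
not-<ᵇ-suc zero j = refl
not-<ᵇ-suc (suc z) zero = refl
not-<ᵇ-suc (suc z) (suc j) = not-<ᵇ-suc z j

∨-absorb-implied : ∀ a b → (T b → T a) → a ∨ b ≡ a
∨-absorb-implied true b b⇒a = refl
∨-absorb-implied false false b⇒a = refl
∨-absorb-implied false true b⇒a with () ← b⇒a tt

∧-congˡ-T : ∀ {a a′} b → (T b → a ≡ a′) → a ∧ b ≡ a′ ∧ b
∧-congˡ-T true eq = cong (_∧ true) (eq tt)
∧-congˡ-T {a} {a′} false eq = trans (∧-zeroʳ a) (sym (∧-zeroʳ a′))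

module _ {A : Set} where

  any-cong : (xs : List A) {p q : A → Bool} → (∀ x → p x ≡ q x) → any p xs ≡ any q xs
  any-cong xs eq = cong or (map-cong eq xs)

  any-∨ : (p q : A → Bool) (xs : List A) → any p xs ∨ any q xs ≡ any (λ x → p x ∨ q x) xs
  any-∨ p q [] = refl
  any-∨ p q (x ∷ xs) =
    trans (∨-interchange (p x) (any p xs) (q x) (any q xs)) (cong ((p x ∨ q x) ∨_) (any-∨ p q xs))

  any-mono : {p q : A → Bool} (xs : List A) → (∀ x → T (p x) → T (q x)) → T (any p xs) → T (any q xs)
  any-mono (x ∷ xs) p⇒q h with Equivalence.to T-∨ h
  ... | inj₁ px = Equivalence.from T-∨ (inj₁ (p⇒q x px))
  ... | inj₂ ps = Equivalence.from T-∨ (inj₂ (any-mono xs p⇒q ps))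

  any-map : {B : Set} (h : B → A) (p : A → Bool) (xs : List B) → any p (map h xs) ≡ any (p ∘ h) xs
  any-map h p xs = cong or (sym (map-∘ xs))

  any-++ : (p : A → Bool) (xs ys : List A) → any p (xs ++ ys) ≡ any p xs ∨ any p ys
  any-++ p [] ys = refl
  any-++ p (x ∷ xs) ys = trans (cong (p x ∨_) (any-++ p xs ys)) (sym (∨-assoc (p x) (any p xs) (any p ys)))

  any-false : (xs : List A) → any (λ _ → false) xs ≡ false
  any-false [] = refl
  any-false (x ∷ xs) = any-false xs

  all-∧ : (p q : A → Bool) (xs : List A) → all (λ x → p x ∧ q x) xs ≡ all p xs ∧ all q xs
  all-∧ p q [] = refl
  all-∧ p q (x ∷ xs) =
    trans (cong ((p x ∧ q x) ∧_) (all-∧ p q xs)) (∧-interchange (p x) (q x) (all p xs) (all q xs))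

all-snoc : (p : ℕ → Bool) (t : List ℕ) (y : ℕ) → all p (snoc t y) ≡ all p t ∧ p y
all-snoc p [] y = ∧-identityʳ (p y)
all-snoc p (x ∷ t) y = trans (cong (p x ∧_) (all-snoc p t y)) (sym (∧-assoc (p x) (all p t) (p y)))

somePair-cong : {P Q : ℕ → ℕ → Bool} (xs : List ℕ) →
  (∀ y z → P y z ≡ Q y z) → somePair P xs ≡ somePair Q xs
somePair-cong [] eq = refl
somePair-cong (x ∷ xs) eq = cong₂ _∨_ (any-cong xs (eq x)) (somePair-cong xs eq)

someTriple-cong : {R S : ℕ → ℕ → ℕ → Bool} (xs : List ℕ) →
  (∀ x y z → R x y z ≡ S x y z) → someTriple R xs ≡ someTriple S xs
someTriple-cong [] eq = refl
someTriple-cong (x ∷ xs) eq = cong₂ _∨_ (somePair-cong xs (eq x)) (someTriple-cong xs eq)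

somePair-∨ : (P Q : ℕ → ℕ → Bool) (xs : List ℕ) →
  somePair P xs ∨ somePair Q xs ≡ somePair (λ y z → P y z ∨ Q y z) xs
somePair-∨ P Q [] = refl
somePair-∨ P Q (x ∷ xs) = trans (∨-interchange (any (P x) xs) _ (any (Q x) xs) _)
  (cong₂ _∨_ (any-∨ (P x) (Q x) xs) (somePair-∨ P Q xs))

someTriple-∨ : (R S : ℕ → ℕ → ℕ → Bool) (xs : List ℕ) →
  someTriple R xs ∨ someTriple S xs ≡ someTriple (λ x y z → R x y z ∨ S x y z) xs
someTriple-∨ R S [] = refl
someTriple-∨ R S (x ∷ xs) = trans (∨-interchange (somePair (R x) xs) _ (somePair (S x) xs) _)
  (cong₂ _∨_ (somePair-∨ (R x) (S x) xs) (someTriple-∨ R S xs))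

somePair-map : (h : ℕ → ℕ) (P : ℕ → ℕ → Bool) (xs : List ℕ) →
  somePair P (map h xs) ≡ somePair (λ y z → P (h y) (h z)) xs
somePair-map h P [] = refl
somePair-map h P (x ∷ xs) = cong₂ _∨_ (any-map h (P (h x)) xs) (somePair-map h P xs)

someTriple-map : (h : ℕ → ℕ) (R : ℕ → ℕ → ℕ → Bool) (xs : List ℕ) →
  someTriple R (map h xs) ≡ someTriple (λ x y z → R (h x) (h y) (h z)) xs
someTriple-map h R [] = refl
someTriple-map h R (x ∷ xs) = cong₂ _∨_ (somePair-map h (R (h x)) xs) (someTriple-map h R xs)

somePair⇒any : {P : ℕ → ℕ → Bool} {q : ℕ → Bool} (xs : List ℕ) →
  (∀ y z → T (P y z) → T (q z)) → T (somePair P xs) → T (any q xs)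
somePair⇒any (x ∷ xs) P⇒q h with Equivalence.to T-∨ h
... | inj₁ p = Equivalence.from T-∨ (inj₂ (any-mono xs (P⇒q x) p))
... | inj₂ p = Equivalence.from T-∨ (inj₂ (somePair⇒any xs P⇒q p))

pat010∨120 : ℕ → ℕ → ℕ → Bool
pat010∨120 x y z = (x <ᵇ y) ∧ (z <ᵇ suc x)

contains010∨120 : List ℕ → Bool
contains010∨120 = someTriple pat010∨120

pat010∨pat120 : ∀ x y z → pat010 x y z ∨ pat120 x y z ≡ pat010∨120 x y z
pat010∨pat120 x y z = begin
  (x ≡ᵇ z) ∧ (x <ᵇ y) ∨ (z <ᵇ x) ∧ (x <ᵇ y)  ≡⟨ ∧-distribʳ-∨ (x <ᵇ y) (x ≡ᵇ z) (z <ᵇ x) ⟨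
  ((x ≡ᵇ z) ∨ (z <ᵇ x)) ∧ (x <ᵇ y)          ≡⟨ cong (_∧ (x <ᵇ y)) (≡ᵇ∨<ᵇ x z) ⟩
  (z <ᵇ suc x) ∧ (x <ᵇ y)                   ≡⟨ ∧-comm (z <ᵇ suc x) (x <ᵇ y) ⟩
  (x <ᵇ y) ∧ (z <ᵇ suc x)                   ∎

avoidsBoth-not-contains : ∀ w → avoidsBoth w ≡ not (contains010∨120 w)
avoidsBoth-not-contains w = trans (if-then-false-else-true (contains010 w ∨ contains120 w))
  (cong not (trans (someTriple-∨ pat010 pat120 w) (someTriple-cong w pat010∨pat120)))
  where
  if-then-false-else-true : ∀ b → (if b then false else true) ≡ not b
  if-then-false-else-true true = refl
  if-then-false-else-true false = refl

pat010∨120-shift : ∀ j x y z → pat010∨120 (j + x) (j + y) (j + z) ≡ pat010∨120 x y z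
pat010∨120-shift zero x y z = refl
pat010∨120-shift (suc j) x y z = pat010∨120-shift j x y z

avoidsBoth-shift : ∀ j w → avoidsBoth (map (j +_) w) ≡ avoidsBoth w
avoidsBoth-shift j w = begin
  avoidsBoth (map (j +_) w)                  ≡⟨ avoidsBoth-not-contains (map (j +_) w) ⟩
  not (contains010∨120 (map (j +_) w))       ≡⟨ cong not (someTriple-map (j +_) pat010∨120 w) ⟩
  not (someTriple (λ x y z → pat010∨120 (j + x) (j + y) (j + z)) w)
                                             ≡⟨ cong not (someTriple-cong w (pat010∨120-shift j)) ⟩
  not (contains010∨120 w)                    ≡⟨ avoidsBoth-not-contains w ⟨
  avoidsBoth w                               ∎

≤-maxList : ∀ xs → All (_≤ maxList xs) xs
≤-maxList [] = []
≤-maxList (x ∷ xs) =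
  m≤m⊔n x (maxList xs) ∷ All.map (λ z≤ → ≤-trans z≤ (m≤n⊔m x (maxList xs))) (≤-maxList xs)

maxList-<⇒All : ∀ {c} xs → maxList xs < c → All (_< c) xs
maxList-<⇒All xs max<c = All.map (λ z≤ → ≤-<-trans z≤ max<c) (≤-maxList xs)

maxList-≤⇒All : ∀ {c} xs → maxList xs ≤ c → All (_≤ c) xs
maxList-≤⇒All xs max≤c = All.map (λ z≤ → ≤-trans z≤ max≤c) (≤-maxList xs)

all-<ᵇ-maxList : ∀ c t → all (_<ᵇ suc c) t ≡ (maxList t <ᵇ suc c)
all-<ᵇ-maxList c [] = refl
all-<ᵇ-maxList c (z ∷ t) =
  trans (cong ((z <ᵇ suc c) ∧_) (all-<ᵇ-maxList c t)) (sym (<ᵇ-⊔ z (maxList t) (suc c)))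

anyAtMost : ℕ → List ℕ → Bool
anyAtMost x t = any (λ z → z <ᵇ suc x) t

anyAtMostAny : List ℕ → List ℕ → Bool
anyAtMostAny u t = any (λ x → anyAtMost x t) u

pat010∨120⇒atMost : ∀ x y z → T (pat010∨120 x y z) → T (z <ᵇ suc x)
pat010∨120⇒atMost x y z h = proj₂ (Equivalence.to T-∧ h)

somePair-pat010∨120-≤ : ∀ {m} {t : List ℕ} → All (_≤ m) t → somePair (pat010∨120 m) t ≡ false
somePair-pat010∨120-≤ [] = refl
somePair-pat010∨120-≤ {m} {y ∷ t} (y≤m ∷ t≤m) rewrite <ᵇ-false y≤m =
  cong₂ _∨_ (any-false t) (somePair-pat010∨120-≤ t≤m)

somePair-pat010∨120-++ : ∀ {x m} t → x < m → ∀ v →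
  somePair (pat010∨120 x) (v ++ m ∷ t) ≡ somePair (pat010∨120 x) v ∨ anyAtMost x t
somePair-pat010∨120-++ {x} {m} t x<m [] rewrite <ᵇ-true x<m =
  ∨-absorb-implied (anyAtMost x t) _ (somePair⇒any t (pat010∨120⇒atMost x))
somePair-pat010∨120-++ {x} {m} t x<m (y ∷ v) = begin
  any P (v ++ m ∷ t) ∨ somePair (pat010∨120 x) (v ++ m ∷ t)
    ≡⟨ cong₂ _∨_ (any-++ P v (m ∷ t)) (somePair-pat010∨120-++ t x<m v) ⟩
  (any P v ∨ (P m ∨ any P t)) ∨ (somePair (pat010∨120 x) v ∨ anyAtMost x t)
    ≡⟨ cong (λ b → (any P v ∨ (b ∨ any P t)) ∨ _) P-m-false ⟩
  (any P v ∨ any P t) ∨ (somePair (pat010∨120 x) v ∨ anyAtMost x t)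
    ≡⟨ ∨-interchange (any P v) (any P t) _ (anyAtMost x t) ⟩
  (any P v ∨ somePair (pat010∨120 x) v) ∨ (any P t ∨ anyAtMost x t)
    ≡⟨ cong ((any P v ∨ somePair (pat010∨120 x) v) ∨_) (trans (∨-comm (any P t) _) P-t-absorbed) ⟩
  (any P v ∨ somePair (pat010∨120 x) v) ∨ anyAtMost x t ∎
  where
  P = pat010∨120 x y
  P-m-false : P m ≡ false
  P-m-false rewrite <ᵇ-false {m} {suc x} x<m = ∧-zeroʳ (x <ᵇ y)
  P-t-absorbed : anyAtMost x t ∨ any P t ≡ anyAtMost x t
  P-t-absorbed = ∨-absorb-implied (anyAtMost x t) (any P t) (any-mono t (pat010∨120⇒atMost x y))

contains010∨120-++ : ∀ {m u t} → All (_< m) u → All (_≤ m) t →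
  contains010∨120 (u ++ m ∷ t) ≡ contains010∨120 u ∨ (contains010∨120 t ∨ anyAtMostAny u t)
contains010∨120-++ {m} {[]} {t} [] t≤m =
  trans (cong (_∨ contains010∨120 t) (somePair-pat010∨120-≤ t≤m)) (sym (∨-identityʳ _))
contains010∨120-++ {m} {x ∷ u} {t} (x<m ∷ u<m) t≤m = begin
  somePair (pat010∨120 x) (u ++ m ∷ t) ∨ contains010∨120 (u ++ m ∷ t)
    ≡⟨ cong₂ _∨_ (somePair-pat010∨120-++ t x<m u) (contains010∨120-++ u<m t≤m) ⟩
  (somePair (pat010∨120 x) u ∨ anyAtMost x t) ∨ (contains010∨120 u ∨ (contains010∨120 t ∨ anyAtMostAny u t))
    ≡⟨ solve 5 (λ p a c c′ r → (p :+ a) :+ (c :+ (c′ :+ r)) := (p :+ c) :+ (c′ :+ (a :+ r))) refl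
         (somePair (pat010∨120 x) u) (anyAtMost x t) (contains010∨120 u) (contains010∨120 t) (anyAtMostAny u t) ⟩
  contains010∨120 (x ∷ u) ∨ (contains010∨120 t ∨ anyAtMostAny (x ∷ u) t) ∎
  where open ∨-∧-Solver

anyAtMostAny-maxList : ∀ x u t → anyAtMostAny (x ∷ u) t ≡ anyAtMost (maxList (x ∷ u)) t
anyAtMostAny-maxList x [] t =
  trans (∨-identityʳ (anyAtMost x t)) (cong (λ y → anyAtMost y t) (sym (⊔-identityʳ x)))
anyAtMostAny-maxList x (y ∷ u) t = begin
  anyAtMost x t ∨ anyAtMostAny (y ∷ u) t          ≡⟨ cong (anyAtMost x t ∨_) (anyAtMostAny-maxList y u t) ⟩
  anyAtMost x t ∨ anyAtMost (maxList (y ∷ u)) t   ≡⟨ any-∨ _ _ t ⟩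
  any (λ z → (z <ᵇ suc x) ∨ (z <ᵇ suc (maxList (y ∷ u)))) t
                                                  ≡⟨ any-cong t (λ z → <ᵇ-suc-⊔ z x (maxList (y ∷ u))) ⟩
  anyAtMost (maxList (x ∷ y ∷ u)) t               ∎

not-anyAtMost : ∀ j t → not (anyAtMost j t) ≡ all (j <ᵇ_) t
not-anyAtMost j [] = refl
not-anyAtMost j (z ∷ t) = trans (deMorgan₂ (z <ᵇ suc j) (anyAtMost j t))
  (cong₂ _∧_ (not-<ᵇ-suc z j) (not-anyAtMost j t))

avoidsBoth-++ : ∀ {m x u t} → All (_< m) (x ∷ u) → All (_≤ m) t →
  avoidsBoth ((x ∷ u) ++ m ∷ t) ≡ avoidsBoth (x ∷ u) ∧ (avoidsBoth t ∧ all (maxList (x ∷ u) <ᵇ_) t)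
avoidsBoth-++ {m} {x} {u} {t} u<m t≤m = begin
  avoidsBoth ((x ∷ u) ++ m ∷ t)
    ≡⟨ avoidsBoth-not-contains ((x ∷ u) ++ m ∷ t) ⟩
  not (contains010∨120 ((x ∷ u) ++ m ∷ t))
    ≡⟨ cong not (contains010∨120-++ u<m t≤m) ⟩
  not (cu ∨ (ct ∨ anyAtMostAny (x ∷ u) t))
    ≡⟨ deMorgan₂ cu (ct ∨ anyAtMostAny (x ∷ u) t) ⟩
  not cu ∧ not (ct ∨ anyAtMostAny (x ∷ u) t)
    ≡⟨ cong (not cu ∧_) (deMorgan₂ ct (anyAtMostAny (x ∷ u) t)) ⟩
  not cu ∧ (not ct ∧ not (anyAtMostAny (x ∷ u) t))
    ≡⟨ cong₂ (λ a b → a ∧ (b ∧ not (anyAtMostAny (x ∷ u) t)))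
             (avoidsBoth-not-contains (x ∷ u)) (avoidsBoth-not-contains t) ⟨
  avoidsBoth (x ∷ u) ∧ (avoidsBoth t ∧ not (anyAtMostAny (x ∷ u) t))
    ≡⟨ cong (λ b → avoidsBoth (x ∷ u) ∧ (avoidsBoth t ∧ not b)) (anyAtMostAny-maxList x u t) ⟩
  avoidsBoth (x ∷ u) ∧ (avoidsBoth t ∧ not (anyAtMost (maxList (x ∷ u)) t))
    ≡⟨ cong (λ b → avoidsBoth (x ∷ u) ∧ (avoidsBoth t ∧ b)) (not-anyAtMost (maxList (x ∷ u)) t) ⟩
  avoidsBoth (x ∷ u) ∧ (avoidsBoth t ∧ all (maxList (x ∷ u) <ᵇ_) t) ∎
  where
  cu = contains010∨120 (x ∷ u)
  ct = contains010∨120 t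

inInterval : ℕ → ℕ → List ℕ → Bool
inInterval j m t = all (λ z → (j <ᵇ z) ∧ (z <ᵇ suc m)) t

inInterval-maxList : ∀ j m t → inInterval j m t ≡ all (j <ᵇ_) t ∧ (maxList t <ᵇ suc m)
inInterval-maxList j m t =
  trans (all-∧ (j <ᵇ_) (_<ᵇ suc m) t) (cong (all (j <ᵇ_) t ∧_) (all-<ᵇ-maxList m t))

avoidsBoth-++-bounded : ∀ {m x u} t → maxList (x ∷ u) < m →
  avoidsBoth ((x ∷ u) ++ m ∷ t) ∧ (maxList t <ᵇ suc m)
    ≡ avoidsBoth (x ∷ u) ∧ (avoidsBoth t ∧ inInterval (maxList (x ∷ u)) m t)
avoidsBoth-++-bounded {m} {x} {u} t max<m = begin
  avoidsBoth ((x ∷ u) ++ m ∷ t) ∧ t≤m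
    ≡⟨ ∧-congˡ-T t≤m (λ h → avoidsBoth-++ (maxList-<⇒All (x ∷ u) max<m)
                              (maxList-≤⇒All t (m<1+n⇒m≤n (<ᵇ⇒< (maxList t) (suc m) h)))) ⟩
  (avoidsBoth (x ∷ u) ∧ (avoidsBoth t ∧ all (j <ᵇ_) t)) ∧ t≤m
    ≡⟨ solve 4 (λ a b c d → (a :* (b :* c)) :* d := a :* (b :* (c :* d))) refl
         (avoidsBoth (x ∷ u)) (avoidsBoth t) (all (j <ᵇ_) t) t≤m ⟩
  avoidsBoth (x ∷ u) ∧ (avoidsBoth t ∧ (all (j <ᵇ_) t ∧ t≤m))
    ≡⟨ cong (λ b → avoidsBoth (x ∷ u) ∧ (avoidsBoth t ∧ b)) (inInterval-maxList j m t) ⟨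
  avoidsBoth (x ∷ u) ∧ (avoidsBoth t ∧ inInterval j m t) ∎
  where
  open ∨-∧-Solver
  j = maxList (x ∷ u)
  t≤m = maxList t <ᵇ suc m

length-snoc : ∀ s y → length (snoc s y) ≡ suc (length s)
length-snoc [] y = refl
length-snoc (x ∷ s) y = cong suc (length-snoc s y)

snoc-++ : ∀ u t y → snoc (u ++ t) y ≡ u ++ snoc t y
snoc-++ [] t y = refl
snoc-++ (x ∷ u) t y = cong (x ∷_) (snoc-++ u t y)

snoc-++-∷ : ∀ u y t → snoc u y ++ t ≡ u ++ y ∷ t
snoc-++-∷ [] y t = refl
snoc-++-∷ (x ∷ u) y t = cong (x ∷_) (snoc-++-∷ u y t)

∑-invSeqs-cong : ∀ n {F G : List ℕ → ℕ} →
  (∀ s → length s ≡ n → F s ≡ G s) → ∑ (invSeqs n) F ≡ ∑ (invSeqs n) G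
∑-invSeqs-cong zero eq = cong (_+ 0) (eq [] refl)
∑-invSeqs-cong (suc n) {F} {G} eq = begin
  ∑ (invSeqs (suc n)) F
    ≡⟨ ∑-extend (upTo (suc n)) snoc (invSeqs n) F ⟩
  ∑[ s ← invSeqs n ] ∑[ y ← upTo (suc n) ] F (snoc s y)
    ≡⟨ ∑-invSeqs-cong n (λ s ∣s∣ → ∑-cong (upTo (suc n)) (λ y →
         eq (snoc s y) (trans (length-snoc s y) (cong suc ∣s∣)))) ⟩
  ∑[ s ← invSeqs n ] ∑[ y ← upTo (suc n) ] G (snoc s y)
    ≡⟨ ∑-extend (upTo (suc n)) snoc (invSeqs n) G ⟨
  ∑ (invSeqs (suc n)) G ∎

invTails : ℕ → ℕ → List (List ℕ)
invTails a zero = [] ∷ []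
invTails a (suc b) = concatMap (λ t → map (snoc t) (upTo (suc (a + b)))) (invTails a b)

∑-invSeqs-++ : ∀ a b (F : List ℕ → ℕ) →
  ∑ (invSeqs (a + b)) F ≡ ∑[ u ← invSeqs a ] ∑[ t ← invTails a b ] F (u ++ t)
∑-invSeqs-++ a zero F rewrite +-identityʳ a =
  ∑-cong (invSeqs a) (λ u → sym (trans (+-identityʳ _) (cong F (++-identityʳ u))))
∑-invSeqs-++ a (suc b) F rewrite +-suc a b = begin
  ∑ (invSeqs (suc (a + b))) F
    ≡⟨ ∑-extend Y snoc (invSeqs (a + b)) F ⟩
  ∑[ s ← invSeqs (a + b) ] ∑[ y ← Y ] F (snoc s y)
    ≡⟨ ∑-invSeqs-++ a b _ ⟩
  ∑[ u ← invSeqs a ] ∑[ t ← invTails a b ] ∑[ y ← Y ] F (snoc (u ++ t) y)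
    ≡⟨ ∑-cong (invSeqs a) (λ u → ∑-cong (invTails a b) (λ t → ∑-cong Y (λ y →
         cong F (snoc-++ u t y)))) ⟩
  ∑[ u ← invSeqs a ] ∑[ t ← invTails a b ] ∑[ y ← Y ] F (u ++ snoc t y)
    ≡⟨ ∑-cong (invSeqs a) (λ u → ∑-extend Y snoc (invTails a b) (λ t → F (u ++ t))) ⟨
  ∑[ u ← invSeqs a ] ∑[ t ← invTails a (suc b) ] F (u ++ t) ∎
  where Y = upTo (suc (a + b))

wordsOver : List ℕ → ℕ → List (List ℕ)
wordsOver L zero = [] ∷ []
wordsOver L (suc N) = concatMap (λ w → map (_∷ w) L) (wordsOver L N)

words≡wordsOver : ∀ N K → words N K ≡ wordsOver (applyUpTo suc K) N
words≡wordsOver zero K = refl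
words≡wordsOver (suc N) K = cong (concatMap (λ w → map (_∷ w) (applyUpTo suc K))) (words≡wordsOver N K)

∑-wordsOver-snoc : ∀ L N (F : List ℕ → ℕ) →
  ∑ (wordsOver L (suc N)) F ≡ ∑[ w ← wordsOver L N ] ∑[ y ← L ] F (snoc w y)
∑-wordsOver-snoc L zero F = ∑-extend L (λ w y → y ∷ w) (wordsOver L zero) F
∑-wordsOver-snoc L (suc N) F = begin
  ∑ (wordsOver L (suc (suc N))) F
    ≡⟨ ∑-extend L (λ w y → y ∷ w) (wordsOver L (suc N)) F ⟩
  ∑[ w ← wordsOver L (suc N) ] ∑[ y ← L ] F (y ∷ w)
    ≡⟨ ∑-wordsOver-snoc L N _ ⟩
  ∑[ w ← wordsOver L N ] ∑[ x ← L ] ∑[ y ← L ] F (y ∷ snoc w x)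
    ≡⟨ ∑-cong (wordsOver L N) (λ w → ∑-comm L L (λ x y → F (y ∷ snoc w x))) ⟩
  ∑[ w ← wordsOver L N ] ∑[ y ← L ] ∑[ x ← L ] F (snoc (y ∷ w) x)
    ≡⟨ ∑-extend L (λ w y → y ∷ w) (wordsOver L N) _ ⟨
  ∑[ v ← wordsOver L (suc N) ] ∑[ x ← L ] F (snoc v x) ∎

∑-wordsOver-map : ∀ (h : ℕ → ℕ) L N (F : List ℕ → ℕ) →
  ∑ (wordsOver (map h L) N) F ≡ ∑ (wordsOver L N) (F ∘ map h)
∑-wordsOver-map h L zero F = refl
∑-wordsOver-map h L (suc N) F = begin
  ∑ (wordsOver (map h L) (suc N)) F
    ≡⟨ ∑-extend (map h L) (λ w y → y ∷ w) (wordsOver (map h L) N) F ⟩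
  ∑[ w ← wordsOver (map h L) N ] ∑[ y ← map h L ] F (y ∷ w)
    ≡⟨ ∑-wordsOver-map h L N _ ⟩
  ∑[ w ← wordsOver L N ] ∑[ y ← map h L ] F (y ∷ map h w)
    ≡⟨ ∑-cong (wordsOver L N) (λ w → ∑-map h L _) ⟩
  ∑[ w ← wordsOver L N ] ∑[ y ← L ] F (map h (y ∷ w))
    ≡⟨ ∑-extend L (λ w y → y ∷ w) (wordsOver L N) (F ∘ map h) ⟨
  ∑ (wordsOver L (suc N)) (F ∘ map h) ∎

∑-upTo-interval : ∀ j K k (G : ℕ → ℕ) → j + K < k →
  ∑[ y ← upTo k ] 𝟙 ((j <ᵇ y) ∧ (y <ᵇ suc (j + K))) * G y ≡ ∑ (map (j +_) (applyUpTo suc K)) G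
∑-upTo-interval j K k G j+K<k = begin
  ∑[ y ← upTo k ] 𝟙 ((j <ᵇ y) ∧ (y <ᵇ suc (j + K))) * G y  ≡⟨ ∑-upTo k _ ⟩
  ∑[ y < k ] 𝟙 ((j <ᵇ y) ∧ (y <ᵇ suc (j + K))) * G y       ≡⟨ sumTo-interval j K k G j+K<k ⟩
  ∑[ i < K ] G (j + suc i)                                  ≡⟨ ∑-applyUpTo suc K (G ∘ (j +_)) ⟨
  ∑ (applyUpTo suc K) (G ∘ (j +_))                          ≡⟨ ∑-map (j +_) (applyUpTo suc K) G ⟨
  ∑ (map (j +_) (applyUpTo suc K)) G                        ∎

-- Since j + K ≤ a, membership in (j, j + K] already implies the inversion-sequence bounds,
-- so at every position the admissible entries are the same alphabet.
∑-invTails-inInterval : ∀ a N j K → j + K ≤ a → (F : List ℕ → ℕ) →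
  ∑[ t ← invTails a N ] 𝟙 (inInterval j (j + K) t) * F t ≡ ∑ (wordsOver (map (j +_) (applyUpTo suc K)) N) F
∑-invTails-inInterval a zero j K j+K≤a F = cong (_+ 0) (*-identityˡ (F []))
∑-invTails-inInterval a (suc N) j K j+K≤a F = begin
  ∑[ t ← invTails a (suc N) ] 𝟙 (I t) * F t
    ≡⟨ ∑-extend Y snoc (invTails a N) _ ⟩
  ∑[ t ← invTails a N ] ∑[ y ← Y ] 𝟙 (I (snoc t y)) * F (snoc t y)
    ≡⟨ ∑-cong (invTails a N) (λ t → ∑-cong Y (λ y → split t y)) ⟩
  ∑[ t ← invTails a N ] ∑[ y ← Y ] 𝟙 (I t) * (𝟙 (inside y) * F (snoc t y))
    ≡⟨ ∑-cong (invTails a N) (λ t → ∑-*ˡ Y (𝟙 (I t)) _) ⟩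
  ∑[ t ← invTails a N ] 𝟙 (I t) * (∑[ y ← Y ] 𝟙 (inside y) * F (snoc t y))
    ≡⟨ ∑-cong (invTails a N) (λ t → cong (𝟙 (I t) *_)
         (∑-upTo-interval j K _ (F ∘ snoc t) (s≤s (≤-trans j+K≤a (m≤m+n a N))))) ⟩
  ∑[ t ← invTails a N ] 𝟙 (I t) * (∑[ y ← L ] F (snoc t y))
    ≡⟨ ∑-invTails-inInterval a N j K j+K≤a _ ⟩
  ∑[ w ← wordsOver L N ] ∑[ y ← L ] F (snoc w y)
    ≡⟨ ∑-wordsOver-snoc L N F ⟨
  ∑ (wordsOver L (suc N)) F ∎
  where
  Y = upTo (suc (a + N))
  L = map (j +_) (applyUpTo suc K)
  I = inInterval j (j + K)
  inside : ℕ → Bool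
  inside y = (j <ᵇ y) ∧ (y <ᵇ suc (j + K))
  split : ∀ t y → 𝟙 (I (snoc t y)) * F (snoc t y) ≡ 𝟙 (I t) * (𝟙 (inside y) * F (snoc t y))
  split t y = begin
    𝟙 (I (snoc t y)) * F (snoc t y)            ≡⟨ cong (λ b → 𝟙 b * F (snoc t y)) (all-snoc inside t y) ⟩
    𝟙 (I t ∧ inside y) * F (snoc t y)          ≡⟨ cong (_* F (snoc t y)) (𝟙-∧ (I t) (inside y)) ⟩
    𝟙 (I t) * 𝟙 (inside y) * F (snoc t y)      ≡⟨ *-assoc (𝟙 (I t)) (𝟙 (inside y)) (F (snoc t y)) ⟩
    𝟙 (I t) * (𝟙 (inside y) * F (snoc t y))    ∎

count-avoiding-invTails : ∀ a N j m → j ≤ m → m ≤ a →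
  ∑[ t ← invTails a N ] 𝟙 (avoidsBoth t ∧ inInterval j m t) ≡ e N (m ∸ j)
count-avoiding-invTails a N j m j≤m m≤a
  rewrite sym (m+[n∸m]≡n j≤m) | m+n∸m≡n j (m ∸ j) = begin
  ∑[ t ← invTails a N ] 𝟙 (avoidsBoth t ∧ inInterval j (j + K) t)
    ≡⟨ ∑-cong (invTails a N) (λ t → trans (𝟙-∧ (avoidsBoth t) _) (*-comm (𝟙 (avoidsBoth t)) _)) ⟩
  ∑[ t ← invTails a N ] 𝟙 (inInterval j (j + K) t) * 𝟙 (avoidsBoth t)
    ≡⟨ ∑-invTails-inInterval a N j K m≤a (𝟙 ∘ avoidsBoth) ⟩
  ∑[ w ← wordsOver (map (j +_) (applyUpTo suc K)) N ] 𝟙 (avoidsBoth w)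
    ≡⟨ ∑-wordsOver-map (j +_) (applyUpTo suc K) N (𝟙 ∘ avoidsBoth) ⟩
  ∑[ w ← wordsOver (applyUpTo suc K) N ] 𝟙 (avoidsBoth (map (j +_) w))
    ≡⟨ ∑-cong (wordsOver (applyUpTo suc K) N) (λ w → cong 𝟙 (avoidsBoth-shift j w)) ⟩
  ∑[ w ← wordsOver (applyUpTo suc K) N ] 𝟙 (avoidsBoth w)
    ≡⟨ cong (λ ws → ∑ ws (𝟙 ∘ avoidsBoth)) (words≡wordsOver N K) ⟨
  ∑[ w ← words N K ] 𝟙 (avoidsBoth w)
    ≡⟨ length-filter-∑ avoidsBoth (words N K) ⟨
  e N K ∎
  where K = m ∸ j

firstMaxAt : ℕ → ℕ → List ℕ → Bool
firstMaxAt m q [] = false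
firstMaxAt m zero (x ∷ t) = (m ≡ᵇ x) ∧ (maxList t <ᵇ suc m)
firstMaxAt m (suc q) (x ∷ t) = (x <ᵇ m) ∧ firstMaxAt m q t

𝟙-⊔-≡ᵇ : ∀ x y m →
  𝟙 (x ⊔ y ≡ᵇ m) ≡ 𝟙 ((m ≡ᵇ x) ∧ (y <ᵇ suc m)) + 𝟙 (x <ᵇ m) * 𝟙 (y ≡ᵇ m)
𝟙-⊔-≡ᵇ zero zero zero = refl
𝟙-⊔-≡ᵇ zero (suc y) zero = refl
𝟙-⊔-≡ᵇ zero y (suc m) = sym (+-identityʳ (𝟙 (y ≡ᵇ suc m)))
𝟙-⊔-≡ᵇ (suc x) zero zero = refl
𝟙-⊔-≡ᵇ (suc x) zero (suc m) =
  sym (trans (cong₂ _+_ (cong 𝟙 (trans (∧-identityʳ (m ≡ᵇ x)) (≡ᵇ-comm m x))) (*-zeroʳ (𝟙 (x <ᵇ m))))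
             (+-identityʳ _))
𝟙-⊔-≡ᵇ (suc x) (suc y) zero = refl
𝟙-⊔-≡ᵇ (suc x) (suc y) (suc m) = 𝟙-⊔-≡ᵇ x y m

𝟙-maxList-firstMaxAt : ∀ k s n → length s ≡ n →
  𝟙 (maxList s ≡ᵇ suc k) ≡ ∑[ q < n ] 𝟙 (firstMaxAt (suc k) q s)
𝟙-maxList-firstMaxAt k [] zero ∣s∣ = refl
𝟙-maxList-firstMaxAt k (x ∷ t) (suc n) ∣s∣ = begin
  𝟙 (x ⊔ maxList t ≡ᵇ m)
    ≡⟨ 𝟙-⊔-≡ᵇ x (maxList t) m ⟩
  𝟙 ((m ≡ᵇ x) ∧ (maxList t <ᵇ suc m)) + 𝟙 (x <ᵇ m) * 𝟙 (maxList t ≡ᵇ m)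
    ≡⟨ cong (λ c → atHead + 𝟙 (x <ᵇ m) * c) (𝟙-maxList-firstMaxAt k t n (suc-injective ∣s∣)) ⟩
  𝟙 ((m ≡ᵇ x) ∧ (maxList t <ᵇ suc m)) + 𝟙 (x <ᵇ m) * (∑[ q < n ] 𝟙 (firstMaxAt m q t))
    ≡⟨ cong (atHead +_) (sumTo-*ˡ n (𝟙 (x <ᵇ m)) _) ⟨
  𝟙 ((m ≡ᵇ x) ∧ (maxList t <ᵇ suc m)) + (∑[ q < n ] 𝟙 (x <ᵇ m) * 𝟙 (firstMaxAt m q t))
    ≡⟨ cong (atHead +_) (sumTo-cong n (λ q _ → 𝟙-∧ (x <ᵇ m) (firstMaxAt m q t))) ⟨
  ∑[ q < suc n ] 𝟙 (firstMaxAt m q (x ∷ t)) ∎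
  where
  m = suc k
  atHead = 𝟙 ((m ≡ᵇ x) ∧ (maxList t <ᵇ suc m))

firstMaxAt-++ : ∀ k u y t →
  firstMaxAt (suc k) (length u) (u ++ y ∷ t)
    ≡ (maxList u <ᵇ suc k) ∧ ((suc k ≡ᵇ y) ∧ (maxList t <ᵇ suc (suc k)))
firstMaxAt-++ k [] y t = refl
firstMaxAt-++ k (x ∷ u) y t = begin
  (x <ᵇ suc k) ∧ firstMaxAt (suc k) (length u) (u ++ y ∷ t)
    ≡⟨ cong ((x <ᵇ suc k) ∧_) (firstMaxAt-++ k u y t) ⟩
  (x <ᵇ suc k) ∧ ((maxList u <ᵇ suc k) ∧ _)
    ≡⟨ ∧-assoc (x <ᵇ suc k) (maxList u <ᵇ suc k) _ ⟨
  ((x <ᵇ suc k) ∧ (maxList u <ᵇ suc k)) ∧ _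
    ≡⟨ cong (_∧ _) (<ᵇ-⊔ x (maxList u) (suc k)) ⟨
  (maxList (x ∷ u) <ᵇ suc k) ∧ _ ∎

boundedAvoider : ℕ → List ℕ → ℕ → List ℕ → Bool
boundedAvoider m u y t = (maxList u <ᵇ m) ∧ (avoidsBoth (u ++ y ∷ t) ∧ (maxList t <ᵇ suc m))

avoidsBoth-firstMaxAt-++ : ∀ k u y t →
  avoidsBoth (u ++ y ∷ t) ∧ firstMaxAt (suc k) (length u) (u ++ y ∷ t)
    ≡ (suc k ≡ᵇ y) ∧ boundedAvoider (suc k) u y t
avoidsBoth-firstMaxAt-++ k u y t rewrite firstMaxAt-++ k u y t =
  solve 4 (λ a p e b → a :* (p :* (e :* b)) := e :* (p :* (a :* b))) refl
    (avoidsBoth (u ++ y ∷ t)) (maxList u <ᵇ suc k) (suc k ≡ᵇ y) (maxList t <ᵇ suc (suc k))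
  where open ∨-∧-Solver

count-firstMaxAt : ∀ k q r →
  ∑[ s ← invSeqs (suc q + r) ] 𝟙 (avoidsBoth s ∧ firstMaxAt (suc k) q s)
    ≡ 𝟙 (suc k <ᵇ suc q)
      * (∑[ u ← invSeqs q ] ∑[ t ← invTails (suc q) r ] 𝟙 (boundedAvoider (suc k) u (suc k) t))
count-firstMaxAt k q r = begin
  ∑ (invSeqs (suc q + r)) F
    ≡⟨ ∑-invSeqs-++ (suc q) r F ⟩
  ∑[ v ← invSeqs (suc q) ] ∑[ t ← Tails ] F (v ++ t)
    ≡⟨ ∑-extend Y snoc (invSeqs q) _ ⟩
  ∑[ u ← invSeqs q ] ∑[ y ← Y ] ∑[ t ← Tails ] F (snoc u y ++ t)
    ≡⟨ ∑-cong (invSeqs q) (λ u → ∑-comm Y Tails _) ⟩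
  ∑[ u ← invSeqs q ] ∑[ t ← Tails ] ∑[ y ← Y ] F (snoc u y ++ t)
    ≡⟨ ∑-invSeqs-cong q (λ u ∣u∣ → ∑-cong Tails (λ t → select-last u t ∣u∣)) ⟩
  ∑[ u ← invSeqs q ] ∑[ t ← Tails ] 𝟙 (m <ᵇ suc q) * 𝟙 (boundedAvoider m u m t)
    ≡⟨ ∑-cong (invSeqs q) (λ u → ∑-*ˡ Tails (𝟙 (m <ᵇ suc q)) _) ⟩
  ∑[ u ← invSeqs q ] 𝟙 (m <ᵇ suc q) * (∑[ t ← Tails ] 𝟙 (boundedAvoider m u m t))
    ≡⟨ ∑-*ˡ (invSeqs q) (𝟙 (m <ᵇ suc q)) _ ⟩
  𝟙 (m <ᵇ suc q) * (∑[ u ← invSeqs q ] ∑[ t ← Tails ] 𝟙 (boundedAvoider m u m t)) ∎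
  where
  m = suc k
  Y = upTo (suc q)
  Tails = invTails (suc q) r
  F : List ℕ → ℕ
  F s = 𝟙 (avoidsBoth s ∧ firstMaxAt m q s)
  select-last : ∀ u t → length u ≡ q →
    ∑[ y ← Y ] F (snoc u y ++ t) ≡ 𝟙 (m <ᵇ suc q) * 𝟙 (boundedAvoider m u m t)
  select-last u t refl = begin
    ∑[ y ← Y ] F (snoc u y ++ t)
      ≡⟨ ∑-cong Y (λ y → cong F (snoc-++-∷ u y t)) ⟩
    ∑[ y ← Y ] F (u ++ y ∷ t)
      ≡⟨ ∑-cong Y (λ y → trans (cong 𝟙 (avoidsBoth-firstMaxAt-++ k u y t)) (𝟙-∧ (m ≡ᵇ y) _)) ⟩
    ∑[ y ← Y ] 𝟙 (m ≡ᵇ y) * 𝟙 (boundedAvoider m u y t)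
      ≡⟨ ∑-upTo (suc q) (λ y → 𝟙 (m ≡ᵇ y) * 𝟙 (boundedAvoider m u y t)) ⟩
    ∑[ y < suc q ] 𝟙 (m ≡ᵇ y) * 𝟙 (boundedAvoider m u y t)
      ≡⟨ sumTo-select (suc q) m (λ y → 𝟙 (boundedAvoider m u y t)) ⟩
    𝟙 (m <ᵇ suc q) * 𝟙 (boundedAvoider m u m t) ∎

∑-invTails-boundedAvoider : ∀ a r m x u → m ≤ a →
  ∑[ t ← invTails a r ] 𝟙 (boundedAvoider m (x ∷ u) m t)
    ≡ 𝟙 (maxList (x ∷ u) <ᵇ m) * (𝟙 (avoidsBoth (x ∷ u)) * e r (m ∸ maxList (x ∷ u)))
∑-invTails-boundedAvoider a r m x u m≤a = begin
  ∑[ t ← invTails a r ] 𝟙 (u<m ∧ rest t)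
    ≡⟨ ∑-cong (invTails a r) (λ t → 𝟙-∧ u<m (rest t)) ⟩
  ∑[ t ← invTails a r ] 𝟙 u<m * 𝟙 (rest t)
    ≡⟨ ∑-*ˡ (invTails a r) (𝟙 u<m) _ ⟩
  𝟙 u<m * (∑[ t ← invTails a r ] 𝟙 (rest t))
    ≡⟨ 𝟙-*-cong u<m (λ h → count-tails (<ᵇ⇒< j m h)) ⟩
  𝟙 u<m * (𝟙 (avoidsBoth (x ∷ u)) * e r (m ∸ j)) ∎
  where
  j = maxList (x ∷ u)
  u<m = j <ᵇ m
  rest : List ℕ → Bool
  rest t = avoidsBoth ((x ∷ u) ++ m ∷ t) ∧ (maxList t <ᵇ suc m)
  count-tails : j < m → ∑[ t ← invTails a r ] 𝟙 (rest t) ≡ 𝟙 (avoidsBoth (x ∷ u)) * e r (m ∸ j)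
  count-tails j<m = begin
    ∑[ t ← invTails a r ] 𝟙 (rest t)
      ≡⟨ ∑-cong (invTails a r) (λ t →
           trans (cong 𝟙 (avoidsBoth-++-bounded {m} {x} {u} t j<m)) (𝟙-∧ (avoidsBoth (x ∷ u)) _)) ⟩
    ∑[ t ← invTails a r ] 𝟙 (avoidsBoth (x ∷ u)) * 𝟙 (avoidsBoth t ∧ inInterval j m t)
      ≡⟨ ∑-*ˡ (invTails a r) (𝟙 (avoidsBoth (x ∷ u))) _ ⟩
    𝟙 (avoidsBoth (x ∷ u)) * (∑[ t ← invTails a r ] 𝟙 (avoidsBoth t ∧ inInterval j m t))
      ≡⟨ cong (𝟙 (avoidsBoth (x ∷ u)) *_) (count-avoiding-invTails a r j m (<⇒≤ j<m) m≤a) ⟩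
    𝟙 (avoidsBoth (x ∷ u)) * e r (m ∸ j) ∎

g-as-∑ : ∀ n j → g n j ≡ ∑[ s ← invSeqs n ] 𝟙 (maxList s ≡ᵇ j) * 𝟙 (avoidsBoth s)
g-as-∑ n j = trans (length-filter-∑ (λ s → avoidsBoth s ∧ (maxList s ≡ᵇ j)) (invSeqs n))
  (∑-cong (invSeqs n) (λ s → trans (𝟙-∧ (avoidsBoth s) _) (*-comm (𝟙 (avoidsBoth s)) _)))

count-boundedAvoider : ∀ k q r → suc k ≤ q →
  ∑[ u ← invSeqs q ] ∑[ t ← invTails (suc q) r ] 𝟙 (boundedAvoider (suc k) u (suc k) t)
    ≡ ∑[ j < suc k ] g q j * e r (suc k ∸ j)
count-boundedAvoider k q r m≤q = begin
  ∑[ u ← invSeqs q ] ∑[ t ← invTails (suc q) r ] 𝟙 (boundedAvoider m u m t)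
    ≡⟨ ∑-invSeqs-cong q count-tails ⟩
  ∑[ u ← invSeqs q ] 𝟙 (maxList u <ᵇ m) * (𝟙 (avoidsBoth u) * e r (m ∸ maxList u))
    ≡⟨ ∑-groupBy maxList (𝟙 ∘ avoidsBoth) m (invSeqs q) (λ j → e r (m ∸ j)) ⟩
  ∑[ j < m ] (∑[ u ← invSeqs q ] 𝟙 (maxList u ≡ᵇ j) * 𝟙 (avoidsBoth u)) * e r (m ∸ j)
    ≡⟨ sumTo-cong m (λ j _ → cong (_* e r (m ∸ j)) (g-as-∑ q j)) ⟨
  ∑[ j < m ] g q j * e r (m ∸ j) ∎
  where
  m = suc k
  count-tails : ∀ u → length u ≡ q → ∑[ t ← invTails (suc q) r ] 𝟙 (boundedAvoider m u m t)
                  ≡ 𝟙 (maxList u <ᵇ m) * (𝟙 (avoidsBoth u) * e r (m ∸ maxList u))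
  count-tails [] refl = contradiction m≤q λ ()
  count-tails (x ∷ u) _ = ∑-invTails-boundedAvoider (suc q) r m x u (m≤n⇒m≤1+n m≤q)

count-firstMaxAt-formula : ∀ k q n → q < n →
  ∑[ s ← invSeqs n ] 𝟙 (avoidsBoth s ∧ firstMaxAt (suc k) q s)
    ≡ 𝟙 (suc k <ᵇ suc q) * (∑[ j < suc k ] g q j * e (n ∸ suc q) (suc k ∸ j))
count-firstMaxAt-formula k q n q<n = begin
  ∑[ s ← invSeqs n ] 𝟙 (avoidsBoth s ∧ firstMaxAt m q s)
    ≡⟨ cong (λ l → ∑[ s ← invSeqs l ] 𝟙 (avoidsBoth s ∧ firstMaxAt m q s)) (m+[n∸m]≡n q<n) ⟨
  ∑[ s ← invSeqs (suc q + r) ] 𝟙 (avoidsBoth s ∧ firstMaxAt m q s)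
    ≡⟨ count-firstMaxAt k q r ⟩
  𝟙 (m <ᵇ suc q) * (∑[ u ← invSeqs q ] ∑[ t ← invTails (suc q) r ] 𝟙 (boundedAvoider m u m t))
    ≡⟨ 𝟙-*-cong (m <ᵇ suc q) (λ h → count-boundedAvoider k q r (m<1+n⇒m≤n (<ᵇ⇒< m (suc q) h))) ⟩
  𝟙 (m <ᵇ suc q) * (∑[ j < m ] g q j * e r (m ∸ j)) ∎
  where
  m = suc k
  r = n ∸ suc q

g-by-firstMaxAt : ∀ n k →
  g n (suc k) ≡ ∑[ q < n ] ∑[ s ← invSeqs n ] 𝟙 (avoidsBoth s ∧ firstMaxAt (suc k) q s)
g-by-firstMaxAt n k = begin
  g n m
    ≡⟨ length-filter-∑ (λ s → avoidsBoth s ∧ (maxList s ≡ᵇ m)) (invSeqs n) ⟩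
  ∑[ s ← invSeqs n ] 𝟙 (avoidsBoth s ∧ (maxList s ≡ᵇ m))
    ≡⟨ ∑-invSeqs-cong n split ⟩
  ∑[ s ← invSeqs n ] ∑[ q < n ] 𝟙 (avoidsBoth s ∧ firstMaxAt m q s)
    ≡⟨ ∑-sumTo-comm (invSeqs n) n _ ⟩
  ∑[ q < n ] ∑[ s ← invSeqs n ] 𝟙 (avoidsBoth s ∧ firstMaxAt m q s) ∎
  where
  m = suc k
  split : ∀ s → length s ≡ n →
    𝟙 (avoidsBoth s ∧ (maxList s ≡ᵇ m)) ≡ ∑[ q < n ] 𝟙 (avoidsBoth s ∧ firstMaxAt m q s)
  split s ∣s∣ = begin
    𝟙 (avoidsBoth s ∧ (maxList s ≡ᵇ m))                       ≡⟨ 𝟙-∧ (avoidsBoth s) _ ⟩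
    𝟙 (avoidsBoth s) * 𝟙 (maxList s ≡ᵇ m)                     ≡⟨ cong (𝟙 (avoidsBoth s) *_) (𝟙-maxList-firstMaxAt k s n ∣s∣) ⟩
    𝟙 (avoidsBoth s) * (∑[ q < n ] 𝟙 (firstMaxAt m q s))      ≡⟨ sumTo-*ˡ n (𝟙 (avoidsBoth s)) _ ⟨
    ∑[ q < n ] 𝟙 (avoidsBoth s) * 𝟙 (firstMaxAt m q s)        ≡⟨ sumTo-cong n (λ q _ → 𝟙-∧ (avoidsBoth s) _) ⟨
    ∑[ q < n ] 𝟙 (avoidsBoth s ∧ firstMaxAt m q s)            ∎

sumFromTo-+1 : ∀ a b f → sumFromTo (a + 1) b f ≡ ∑[ i < b ∸ a ] f (suc (a + i))
sumFromTo-+1 a b f rewrite +-comm a 1 = ∑-upTo (b ∸ a) _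

theorem3 : (n m : ℕ) → m ≥ 1 →
    g n m ≡ sumFromTo (m + 1) n (λ p →
              sumFromTo 0 (m ∸ 1) (λ j → g (p ∸ 1) j * e (n ∸ p) (m ∸ j)))
theorem3 n m@(suc k) _ = begin
  g n m
    ≡⟨ g-by-firstMaxAt n k ⟩
  ∑[ q < n ] ∑[ s ← invSeqs n ] 𝟙 (avoidsBoth s ∧ firstMaxAt m q s)
    ≡⟨ sumTo-cong n (λ q → count-firstMaxAt-formula k q n) ⟩
  ∑[ q < n ] 𝟙 (m <ᵇ suc q) * Z q
    ≡⟨ sumTo-from m n Z ⟩
  ∑[ i < n ∸ m ] Z (m + i)
    ≡⟨ sumTo-cong (n ∸ m) (λ i _ → ∑-upTo m _) ⟨
  ∑[ i < n ∸ m ] f (suc (m + i))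
    ≡⟨ sumFromTo-+1 m n f ⟨
  sumFromTo (m + 1) n f ∎
  where
  Z : ℕ → ℕ
  Z q = ∑[ j < m ] g q j * e (n ∸ suc q) (m ∸ j)
  f : ℕ → ℕ
  f p = sumFromTo 0 (m ∸ 1) (λ j → g (p ∸ 1) j * e (n ∸ p) (m ∸ j))
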